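{- Let $\gamma$ be a symbolic event structure, and let $C_{\mathrm{ws}}=\{\neg c_{ww'}\Rightarrow c_{w'w}\mid w,w' \text{ writes with } \mathrm{addr}(w)=\mathrm{addr}(w'),\ \mathrm{tid}(w)\neq\mathrm{tid}(w')\}$. Then a valuation $(C,V)$ satisfies $\bigwedge_{c\in C_{\mathrm{ws}}} c$ if and only if it satisfies $\bigwedge_{(w,w')\in \mathrm{wse}(\gamma)} c_{ww'}$.
   Context: A symbolic event structure $\gamma$ has symbolic read/write events $e$, each with a thread identifier $\mathrm{tid}(e)$, a memory address $\mathrm{addr}(e)$ and a Boolean guard $g(e)$ (a formula over symbols valued by $V$); each event $x$ has a clock variable $\mathrm{clk}(x)\in\mathbb{N}$ valued by $C$, and $c_{xy}$ denotes $(g(x)\wedge g(y))\Rightarrow \mathrm{clk}(x)<\mathrm{clk}(y)$. Let $\mathrm{ws}(\gamma)=\{(w,w')\mid w,w'\text{ writes},\ \mathrm{addr}(w)=\mathrm{addr}(w'),\ c_{w'w}\text{ is false}\}$ and $\mathrm{wse}(\gamma)=\mathrm{ws}(\gamma)\cap\{(w,w')\mid\mathrm{tid}(w)\neq\mathrm{tid}(w')\}$; membership in these sets is determined by the valuation $(C,V)$ under consideration. -}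

module Defs where

open import Data.Nat using (ℕ; _<_)
open import Data.Bool using (Bool; T)
open import Data.Product using (_×_)
open import Relation.Nullary using (¬_)
open import Relation.Binary.PropositionalEquality using (_≡_; _≢_)

data Kind : Set where
  read  : Kind
  write : Kind

-- Each guard is a Boolean formula over the symbols, represented semantically
-- by its truth value under a symbol valuation V : Sym → Val.
record SES (Sym Val : Set) : Set₁ where
  field
    Event : Set
    kind  : Event → Kind
    tid   : Event → ℕ
    addr  : Event → ℕ
    guard : Event → (Sym → Val) → Bool

module _ {Sym Val : Set} (γ : SES Sym Val) where
  open SES γ

  IsWrite : Event → Set
  IsWrite e = kind e ≡ write

  c : (C : Event → ℕ) (V : Sym → Val) → Event → Event → Set
  c C V x y = T (guard x V) → T (guard y V) → C x < C y

  InWs : (C : Event → ℕ) (V : Sym → Val) → Event → Event → Set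
  InWs C V w w' = IsWrite w × IsWrite w' × addr w ≡ addr w' × ¬ c C V w' w

  InWse : (C : Event → ℕ) (V : Sym → Val) → Event → Event → Set
  InWse C V w w' = InWs C V w w' × tid w ≢ tid w'

  SatCws : (C : Event → ℕ) (V : Sym → Val) → Set
  SatCws C V = ∀ w w' → IsWrite w → IsWrite w' → addr w ≡ addr w' → tid w ≢ tid w' →
               (¬ c C V w w' → c C V w' w)

  SatWse : (C : Event → ℕ) (V : Sym → Val) → Set
  SatWse C V = ∀ w w' → InWse C V w w' → c C V w w'

module Submission where

-- Both conditions talk about the same pairs of writes: two
-- writes w, w' to one address issued by different threads.  For such a
-- pair, the constraint ¬ c_ww' ⇒ c_w'w of C_ws says exactly "if the
-- swapped pair (w' , w) lies in wse(γ), then c_w'w holds", because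
-- (w' , w) ∈ ws(γ) means precisely that c_ww' fails.  So the lemma is a
-- re-indexing by the swap (w , w') ↦ (w' , w), using that equality of
-- addresses and disequality of thread identifiers are symmetric.

open import Defs
open import Data.Nat using (ℕ)
open import Data.Product using (_×_; _,_)
open import Relation.Nullary using (¬_)
open import Relation.Binary.PropositionalEquality using (_≡_; _≢_; sym; ≢-sym)

module _ {Sym Val : Set} (γ : SES Sym Val) (C : SES.Event γ → ℕ) (V : Sym → Val) where
  open SES γ

  inWse-swap : ∀ {w w'} → IsWrite γ w → IsWrite γ w' → addr w ≡ addr w' →
               tid w ≢ tid w' → ¬ c γ C V w w' → InWse γ C V w' w
  inWse-swap iw iw' same-addr diff-tid ¬c =
    (iw' , iw , sym same-addr , ¬c) , ≢-sym diff-tid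

  wse-swap-premises : ∀ {w w'} → InWse γ C V w w' →
                      IsWrite γ w' × IsWrite γ w × addr w' ≡ addr w ×
                      tid w' ≢ tid w × ¬ c γ C V w' w
  wse-swap-premises ((iw , iw' , same-addr , ¬c) , diff-tid) =
    iw' , iw , sym same-addr , ≢-sym diff-tid , ¬c

  satCws⇒satWse : SatCws γ C V → SatWse γ C V
  satCws⇒satWse cws w w' inWse with wse-swap-premises inWse
  ... | iw' , iw , same-addr , diff-tid , ¬c = cws w' w iw' iw same-addr diff-tid ¬c

  satWse⇒satCws : SatWse γ C V → SatCws γ C V
  satWse⇒satCws wse w w' iw iw' same-addr diff-tid ¬c =
    wse w' w (inWse-swap iw iw' same-addr diff-tid ¬c)

lemma4 : {Sym Val : Set} (γ : SES Sym Val) (C : SES.Event γ → ℕ) (V : Sym → Val) →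
    (SatCws γ C V → SatWse γ C V) × (SatWse γ C V → SatCws γ C V)
lemma4 γ C V = satCws⇒satWse γ C V , satWse⇒satCws γ C V
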